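{- For every $n\ge 5$, there exists an absolute constant $c>0$ such that there is a red/blue coloring $\phi$ of the pairs of $\{0,1,\ldots,\lfloor 2^{cn}\rfloor-1\}$ with the property that every $n$-element set $A\subset\{0,1,\ldots,\lfloor 2^{cn}\rfloor-1\}$ contains a $6$-tuple $a_1<a_2<a_3<a_4<a_5<a_6$ of elements of $A$ satisfying \[ \phi(a_1,a_4)=\phi(a_2,a_4)=\phi(a_3,a_4)=\phi(a_3,a_5)=\phi(a_4,a_5)=\text{red}, \] \[ \phi(a_1,a_2)=\phi(a_1,a_3)=\phi(a_2,a_3)=\phi(a_3,a_6)=\phi(a_4,a_6)=\phi(a_5,a_6)=\text{blue}. \] -}

module Defs where

open import Data.Nat using (ℕ; suc; _+_; _*_; _^_; _≤_; _<_)
open import Data.Fin using (Fin)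
import Data.Fin as F
open import Data.Fin.Subset using (Subset; _∈_; ∣_∣)
open import Data.Product using (Σ; ∃; _×_; _,_)
open import Relation.Binary.PropositionalEquality using (_≡_)

data Color : Set where
  red blue : Color

-- A red/blue colouring of the pairs of {0,…,N-1}.  It is only ever
-- evaluated at φ a b with a < b, so it represents a colouring of
-- unordered pairs (φ(a,b) with a < b).
Coloring : ℕ → Set
Coloring N = Fin N → Fin N → Color

Pattern : {N : ℕ} → Coloring N → Subset N → Set
Pattern {N} φ A =
  Σ (Fin N) λ a1 → Σ (Fin N) λ a2 → Σ (Fin N) λ a3 →
  Σ (Fin N) λ a4 → Σ (Fin N) λ a5 → Σ (Fin N) λ a6 →
    (a1 ∈ A × a2 ∈ A × a3 ∈ A × a4 ∈ A × a5 ∈ A × a6 ∈ A)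
  × (a1 F.< a2 × a2 F.< a3 × a3 F.< a4 × a4 F.< a5 × a5 F.< a6)
  × (φ a1 a4 ≡ red × φ a2 a4 ≡ red × φ a3 a4 ≡ red
     × φ a3 a5 ≡ red × φ a4 a5 ≡ red)
  × (φ a1 a2 ≡ blue × φ a1 a3 ≡ blue × φ a2 a3 ≡ blue
     × φ a3 a6 ≡ blue × φ a4 a6 ≡ blue × φ a5 a6 ≡ blue)

Good : ℕ → ℕ → Set
Good N n = Σ (Coloring N) λ φ → (A : Subset N) → ∣ A ∣ ≡ n → Pattern φ A

-- N is ⌊ 2^(c n) ⌋ for c = p / q (q ≥ 1):  N^q ≤ 2^(p n) < (N+1)^q.
IsFloorPow2 : (p q n N : ℕ) → Set
IsFloorPow2 p q n N = (N ^ q ≤ 2 ^ (p * n)) × (2 ^ (p * n) < suc N ^ q)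

module Submission where

-- Colour the pairs at random: a colouring is a vector v of N·N bits, and probabilities
-- are counts over the Boolean cube.  Lay the first 36k elements of an n-set A (k = ⌊n/36⌋)
-- out as a 6 × 6k grid read row by row; each of the k² lines y = a x + b (a, b < k) gives
-- an increasing 6-tuple of A.  Two lines meet at most once, so the k² events "this tuple
-- carries the required 11 colours" concern pairwise disjoint sets of pairs; they are
-- independent, each of probability 2⁻¹¹.  A union bound over the at most N ^ n sets A
-- leaves a good colouring as soon as N ^ n (2047/2048) ^ k² < 1, which holds when
-- N ≤ 2 ^ (n / c⁻¹).

open import Defs
open import Data.Bool using (Bool; true; false; T; _xor_; if_then_else_)
open import Data.Bool.Properties using (xor-comm) renaming (_≟_ to _≟ᴮ_)
open import Data.Empty using (⊥-elim)
open import Data.Fin as F using (Fin; zero; suc; #_; toℕ; combine; remQuot; fromℕ<; inject≤)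
import Data.Fin.Properties as Finₚ
open import Data.Fin.Subset using (Subset; _∈_; ∣_∣)
open import Data.Fin.Subset.Properties using (∣p∣≤n)
open import Data.Nat using (ℕ; zero; suc; _+_; _*_; _^_; _≤_; _<_; _≤?_; _<?_; _≡ᵇ_; NonZero; s≤s; z≤n)
open import Data.Nat.DivMod using (_/_; _%_; m≡m%n+[m/n]*n; m%n<n; m≥n⇒m/n>0; m/n*n≤m)
open import Data.Nat.Properties
open import Data.Nat.Tactic.RingSolver using (solve-∀)
open import Data.Product using (Σ; ∃; _×_; _,_; proj₁; proj₂; uncurry)
import Data.Product.Properties as Productₚ
open import Data.Sum using (inj₁; inj₂)
open import Data.Unit using (tt)
open import Data.Vec using (Vec; []; _∷_; lookup; tabulate; replicate; zipWith; _[_]≔_; here; there)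
open import Data.Vec.Properties using (≡-dec; lookup∘tabulate; tabulate∘lookup; tabulate-cong;
  lookup-zipWith; zipWith-comm; lookup∘update; lookup∘update′; lookup-replicate)
open import Data.Vec.Relation.Unary.AllPairs using (allPairs?)
open import Data.Vec.Relation.Unary.Unique.Propositional using (Unique)
open import Data.Vec.Relation.Unary.Unique.Propositional.Properties using (lookup-injective)
open import Algebra.Properties.CommutativeSemigroup +-commutativeSemigroup using (interchange; x∙yz≈y∙xz)
open import Algebra.Properties.Monoid.Sum *-1-monoid using () renaming (sum to ∏; sum-cong-≗ to ∏-cong)
open import Function using (_∘_)
open import Function.Bundles using (Injection)
open import Function.Definitions using (Injective)
open import Function.Properties.Inverse using (↔⇒↣)
open import Relation.Binary using (tri<; tri≈; tri>; _Preserves_⟶_)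
open import Relation.Binary.PropositionalEquality
open import Relation.Nullary using (does; yes; no; ¬?)
open import Relation.Nullary.Decidable using (toWitness; from-yes)

private variable
  K L M : ℕ

infixl 6 _⊕_

_⊕_ : Vec Bool M → Vec Bool M → Vec Bool M
_⊕_ = zipWith _xor_

cubeSum : ∀ M → (Vec Bool M → ℕ) → ℕ
cubeSum zero    f = f []
cubeSum (suc M) f = cubeSum M (f ∘ (true ∷_)) + cubeSum M (f ∘ (false ∷_))

cubeSum-cong : ∀ M {f g : Vec Bool M → ℕ} → f ≗ g → cubeSum M f ≡ cubeSum M g
cubeSum-cong zero    f≗g = f≗g []
cubeSum-cong (suc M) f≗g =
  cong₂ _+_ (cubeSum-cong M (f≗g ∘ (true ∷_))) (cubeSum-cong M (f≗g ∘ (false ∷_)))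

cubeSum-mono-≤ : ∀ M {f g : Vec Bool M → ℕ} → (∀ v → f v ≤ g v) → cubeSum M f ≤ cubeSum M g
cubeSum-mono-≤ zero    f≤g = f≤g []
cubeSum-mono-≤ (suc M) f≤g =
  +-mono-≤ (cubeSum-mono-≤ M (f≤g ∘ (true ∷_))) (cubeSum-mono-≤ M (f≤g ∘ (false ∷_)))

cubeSum-const : ∀ M c → cubeSum M (λ _ → c) ≡ 2 ^ M * c
cubeSum-const zero    c = sym (*-identityˡ c)
cubeSum-const (suc M) c = begin
  cubeSum M (λ _ → c) + cubeSum M (λ _ → c) ≡⟨ cong₂ _+_ (cubeSum-const M c) (cubeSum-const M c) ⟩
  2 ^ M * c + 2 ^ M * c                     ≡⟨ sym (*-distribʳ-+ c (2 ^ M) (2 ^ M)) ⟩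
  (2 ^ M + 2 ^ M) * c                       ≡⟨ cong (λ x → (2 ^ M + x) * c) (sym (+-identityʳ (2 ^ M))) ⟩
  2 ^ suc M * c                             ∎
  where open ≡-Reasoning

cubeSum-ones : ∀ M → cubeSum M (λ _ → 1) ≡ 2 ^ M
cubeSum-ones M = trans (cubeSum-const M 1) (*-identityʳ (2 ^ M))

cubeSum-distrib-+ : ∀ M (f g : Vec Bool M → ℕ) →
                    cubeSum M (λ v → f v + g v) ≡ cubeSum M f + cubeSum M g
cubeSum-distrib-+ zero    f g = refl
cubeSum-distrib-+ (suc M) f g =
  trans (cong₂ _+_ (cubeSum-distrib-+ M (f ∘ (true ∷_)) (g ∘ (true ∷_)))
                   (cubeSum-distrib-+ M (f ∘ (false ∷_)) (g ∘ (false ∷_))))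
        (interchange (cubeSum M (f ∘ (true ∷_))) (cubeSum M (g ∘ (true ∷_)))
                     (cubeSum M (f ∘ (false ∷_))) (cubeSum M (g ∘ (false ∷_))))

cubeSum-*ˡ : ∀ M c (f : Vec Bool M → ℕ) → cubeSum M (λ v → c * f v) ≡ c * cubeSum M f
cubeSum-*ˡ zero    c f = refl
cubeSum-*ˡ (suc M) c f =
  trans (cong₂ _+_ (cubeSum-*ˡ M c _) (cubeSum-*ˡ M c _)) (sym (*-distribˡ-+ c _ _))

cubeSum-*ʳ : ∀ M c (f : Vec Bool M → ℕ) → cubeSum M (λ v → f v * c) ≡ cubeSum M f * c
cubeSum-*ʳ M c f =
  trans (cubeSum-cong M (λ v → *-comm (f v) c)) (trans (cubeSum-*ˡ M c f) (*-comm c (cubeSum M f)))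

cubeSum-comm : ∀ M K (F : Vec Bool M → Vec Bool K → ℕ) →
               cubeSum M (λ v → cubeSum K (F v)) ≡ cubeSum K (λ w → cubeSum M (λ v → F v w))
cubeSum-comm zero    K F = refl
cubeSum-comm (suc M) K F =
  trans (cong₂ _+_ (cubeSum-comm M K (F ∘ (true ∷_))) (cubeSum-comm M K (F ∘ (false ∷_))))
        (sym (cubeSum-distrib-+ K (λ w → cubeSum M (λ v → F (true ∷ v) w))
                                  (λ w → cubeSum M (λ v → F (false ∷ v) w))))

cubeSum-translate : ∀ M (w : Vec Bool M) (f : Vec Bool M → ℕ) → cubeSum M (f ∘ (w ⊕_)) ≡ cubeSum M f
cubeSum-translate zero    []          f = refl
cubeSum-translate (suc M) (false ∷ w) f =
  cong₂ _+_ (cubeSum-translate M w (f ∘ (true ∷_))) (cubeSum-translate M w (f ∘ (false ∷_)))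
cubeSum-translate (suc M) (true ∷ w)  f =
  trans (cong₂ _+_ (cubeSum-translate M w (f ∘ (false ∷_))) (cubeSum-translate M w (f ∘ (true ∷_))))
        (+-comm (cubeSum M (f ∘ (false ∷_))) (cubeSum M (f ∘ (true ∷_))))

cubeSum≡0⇒≡0 : ∀ M (f : Vec Bool M → ℕ) → cubeSum M f ≡ 0 → ∀ v → f v ≡ 0
cubeSum≡0⇒≡0 zero    f eq []          = eq
cubeSum≡0⇒≡0 (suc M) f eq (true ∷ v)  = cubeSum≡0⇒≡0 M _ (m+n≡0⇒m≡0 _ eq) v
cubeSum≡0⇒≡0 (suc M) f eq (false ∷ v) = cubeSum≡0⇒≡0 M _ (m+n≡0⇒n≡0 _ eq) v

cubeSum<2^M⇒∃≡0 : ∀ M (f : Vec Bool M → ℕ) → cubeSum M f < 2 ^ M → ∃ λ v → f v ≡ 0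
cubeSum<2^M⇒∃≡0 zero f lt with f [] in eq
... | zero  = [] , eq
... | suc _ = ⊥-elim (<-irrefl refl (≤-trans lt (s≤s z≤n)))
cubeSum<2^M⇒∃≡0 (suc M) f lt with cubeSum M (f ∘ (true ∷_)) <? 2 ^ M
... | yes lt₁ = let v , eq = cubeSum<2^M⇒∃≡0 M _ lt₁ in true ∷ v , eq
... | no ¬lt₁ = let v , eq = cubeSum<2^M⇒∃≡0 M _ lt₀ in false ∷ v , eq
  where
  lt₀ : cubeSum M (f ∘ (false ∷_)) < 2 ^ M
  lt₀ = +-cancelˡ-< (2 ^ M) _ _ (≤-<-trans (+-monoˡ-≤ _ (≮⇒≥ ¬lt₁))
          (≤-trans lt (≤-reflexive (cong (2 ^ M +_) (+-identityʳ _)))))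

_↾_ : Vec Bool M → (Fin K → Fin M) → Vec Bool K
v ↾ cs = tabulate (lookup v ∘ cs)

Disjoint : (Fin K → Fin M) → (Fin L → Fin M) → Set
Disjoint cs ds = ∀ k l → cs k ≢ ds l

mask : (Fin K → Fin M) → Vec Bool K → Vec Bool M
mask cs []       = replicate _ false
mask cs (b ∷ bs) = mask (cs ∘ suc) bs [ cs zero ]≔ b

lookup-mask-∉ : (cs : Fin K → Fin M) (bs : Vec Bool K) {j : Fin M} →
                (∀ k → j ≢ cs k) → lookup (mask cs bs) j ≡ false
lookup-mask-∉ cs []       {j} j∉ = lookup-replicate j false
lookup-mask-∉ cs (b ∷ bs) {j} j∉ =
  trans (lookup∘update′ (j∉ zero) (mask (cs ∘ suc) bs) b) (lookup-mask-∉ (cs ∘ suc) bs (j∉ ∘ suc))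

lookup-mask-∈ : (cs : Fin K → Fin M) → Injective _≡_ _≡_ cs →
                ∀ bs k → lookup (mask cs bs) (cs k) ≡ lookup bs k
lookup-mask-∈ cs inj (b ∷ bs) zero    = lookup∘update (cs zero) (mask (cs ∘ suc) bs) b
lookup-mask-∈ cs inj (b ∷ bs) (suc k) =
  trans (lookup∘update′ (Finₚ.0≢1+n ∘ inj ∘ sym) (mask (cs ∘ suc) bs) b)
        (lookup-mask-∈ (cs ∘ suc) (Finₚ.suc-injective ∘ inj) bs k)

↾-≡ : (v : Vec Bool M) (cs : Fin K → Fin M) (u : Vec Bool K) →
      (∀ k → lookup v (cs k) ≡ lookup u k) → v ↾ cs ≡ u
↾-≡ v cs u eq = trans (tabulate-cong eq) (tabulate∘lookup u)

↾-⊕ : (w v : Vec Bool M) (cs : Fin K → Fin M) → (w ⊕ v) ↾ cs ≡ (w ↾ cs) ⊕ (v ↾ cs)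
↾-⊕ w v cs = ↾-≡ (w ⊕ v) cs _ λ k → begin
  lookup (w ⊕ v) (cs k)                         ≡⟨ lookup-zipWith _xor_ (cs k) w v ⟩
  lookup w (cs k) xor lookup v (cs k)           ≡⟨ sym (cong₂ _xor_ (lookup∘tabulate _ k) (lookup∘tabulate _ k)) ⟩
  lookup (w ↾ cs) k xor lookup (v ↾ cs) k       ≡⟨ sym (lookup-zipWith _xor_ k (w ↾ cs) (v ↾ cs)) ⟩
  lookup ((w ↾ cs) ⊕ (v ↾ cs)) k                ∎
  where open ≡-Reasoning

mask-↾ : (cs : Fin K → Fin M) → Injective _≡_ _≡_ cs → ∀ bs → mask cs bs ↾ cs ≡ bs
mask-↾ cs inj bs = ↾-≡ (mask cs bs) cs bs (lookup-mask-∈ cs inj bs)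

mask-⊕-↾-disjoint : (cs : Fin K → Fin M) (ds : Fin L → Fin M) → Disjoint cs ds →
                    ∀ bs v → (mask cs bs ⊕ v) ↾ ds ≡ v ↾ ds
mask-⊕-↾-disjoint cs ds disj bs v = tabulate-cong λ l →
  trans (lookup-zipWith _xor_ (ds l) (mask cs bs) v)
        (cong (_xor lookup v (ds l)) (lookup-mask-∉ cs bs (λ k → ≢-sym (disj k l))))

-- P ignores the coordinates cs; averaging over the translates by mask cs bs makes v ↾ cs uniform.
cubeSum-independent : (cs : Fin K → Fin M) → Injective _≡_ _≡_ cs → (f : Vec Bool K → ℕ) →
  (P : Vec Bool M → ℕ) → (∀ bs v → P (mask cs bs ⊕ v) ≡ P v) →
  cubeSum M (λ v → f (v ↾ cs) * P v) * 2 ^ K ≡ cubeSum K f * cubeSum M P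
cubeSum-independent {K} {M} cs inj f P P-inv = begin
  cubeSum M g * 2 ^ K
    ≡⟨ trans (*-comm _ (2 ^ K)) (sym (cubeSum-const K (cubeSum M g))) ⟩
  cubeSum K (λ bs → cubeSum M g)
    ≡⟨ cubeSum-cong K (λ bs → sym (cubeSum-translate M (mask cs bs) g)) ⟩
  cubeSum K (λ bs → cubeSum M (λ v → g (mask cs bs ⊕ v)))
    ≡⟨ cubeSum-cong K (λ bs → cubeSum-cong M (λ v → cong₂ _*_ (cong f (restrict bs v)) (P-inv bs v))) ⟩
  cubeSum K (λ bs → cubeSum M (λ v → f ((v ↾ cs) ⊕ bs) * P v))
    ≡⟨ sym (cubeSum-comm M K _) ⟩
  cubeSum M (λ v → cubeSum K (λ bs → f ((v ↾ cs) ⊕ bs) * P v))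
    ≡⟨ cubeSum-cong M (λ v → trans (cubeSum-*ʳ K (P v) _) (cong (_* P v) (cubeSum-translate K (v ↾ cs) f))) ⟩
  cubeSum M (λ v → cubeSum K f * P v)
    ≡⟨ cubeSum-*ˡ M (cubeSum K f) P ⟩
  cubeSum K f * cubeSum M P ∎
  where
  open ≡-Reasoning
  g : Vec Bool M → ℕ
  g v = f (v ↾ cs) * P v
  restrict : ∀ bs v → (mask cs bs ⊕ v) ↾ cs ≡ (v ↾ cs) ⊕ bs
  restrict bs v = trans (↾-⊕ (mask cs bs) v cs)
                        (trans (cong (_⊕ (v ↾ cs)) (mask-↾ cs inj bs)) (zipWith-comm xor-comm bs (v ↾ cs)))

cubeSum-∏-independent : ∀ {m} (cs : Fin m → Fin K → Fin M) →
  (∀ p → Injective _≡_ _≡_ (cs p)) → (∀ {p p′} → p ≢ p′ → Disjoint (cs p) (cs p′)) →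
  (f : Vec Bool K → ℕ) →
  cubeSum M (λ v → ∏ (λ p → f (v ↾ cs p))) * (2 ^ K) ^ m ≡ cubeSum K f ^ m * 2 ^ M
cubeSum-∏-independent {K} {M} {zero}  cs inj disj f =
  trans (*-identityʳ _) (trans (cubeSum-ones M) (sym (*-identityˡ (2 ^ M))))
cubeSum-∏-independent {K} {M} {suc m} cs inj disj f = begin
  cubeSum M (λ v → f (v ↾ cs zero) * P v) * (2 ^ K * (2 ^ K) ^ m)
    ≡⟨ sym (*-assoc (cubeSum M (λ v → f (v ↾ cs zero) * P v)) (2 ^ K) _) ⟩
  cubeSum M (λ v → f (v ↾ cs zero) * P v) * 2 ^ K * (2 ^ K) ^ m
    ≡⟨ cong (_* (2 ^ K) ^ m) (cubeSum-independent (cs zero) (inj zero) f P P-inv) ⟩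
  cubeSum K f * cubeSum M P * (2 ^ K) ^ m
    ≡⟨ *-assoc (cubeSum K f) (cubeSum M P) _ ⟩
  cubeSum K f * (cubeSum M P * (2 ^ K) ^ m)
    ≡⟨ cong (cubeSum K f *_) (cubeSum-∏-independent (cs ∘ suc) (inj ∘ suc) (disj ∘ (_∘ Finₚ.suc-injective)) f) ⟩
  cubeSum K f * (cubeSum K f ^ m * 2 ^ M)
    ≡⟨ sym (*-assoc (cubeSum K f) (cubeSum K f ^ m) _) ⟩
  cubeSum K f ^ suc m * 2 ^ M ∎
  where
  open ≡-Reasoning
  P : Vec Bool M → ℕ
  P v = ∏ (λ p → f (v ↾ cs (suc p)))
  P-inv : ∀ bs v → P (mask (cs zero) bs ⊕ v) ≡ P v
  P-inv bs v = ∏-cong (λ p → cong f (mask-⊕-↾-disjoint (cs zero) (cs (suc p)) (disj (λ ())) bs v))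

∏≡0⇒∃≡0 : ∀ {m} (f : Fin m → ℕ) → ∏ f ≡ 0 → ∃ λ p → f p ≡ 0
∏≡0⇒∃≡0 {suc m} f eq with m*n≡0⇒m≡0∨n≡0 (f zero) eq
... | inj₁ f₀≡0 = zero , f₀≡0
... | inj₂ rest≡0 = let p , fp≡0 = ∏≡0⇒∃≡0 (f ∘ suc) rest≡0 in suc p , fp≡0

miss : Vec Bool K → Vec Bool K → ℕ
miss ts u = if does (≡-dec _≟ᴮ_ u ts) then 0 else 1

miss≡0⇒≡ : (ts u : Vec Bool K) → miss ts u ≡ 0 → u ≡ ts
miss≡0⇒≡ ts u eq with ≡-dec _≟ᴮ_ u ts
... | yes u≡ts = u≡ts

1+cubeSum-miss : ∀ K (ts : Vec Bool K) → 1 + cubeSum K (miss ts) ≡ 2 ^ K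
1+cubeSum-miss zero    []       = refl
1+cubeSum-miss (suc K) (true ∷ ts) = begin
  1 + (cubeSum K (miss ts) + cubeSum K (λ _ → 1)) ≡⟨ sym (+-assoc 1 (cubeSum K (miss ts)) _) ⟩
  (1 + cubeSum K (miss ts)) + cubeSum K (λ _ → 1) ≡⟨ cong₂ _+_ (1+cubeSum-miss K ts) (cubeSum-ones K) ⟩
  2 ^ K + 2 ^ K                                   ≡⟨ cong (2 ^ K +_) (sym (+-identityʳ _)) ⟩
  2 ^ suc K                                       ∎
  where open ≡-Reasoning
1+cubeSum-miss (suc K) (false ∷ ts) = begin
  1 + (cubeSum K (λ _ → 1) + cubeSum K (miss ts)) ≡⟨ x∙yz≈y∙xz 1 (cubeSum K (λ _ → 1)) _ ⟩
  cubeSum K (λ _ → 1) + (1 + cubeSum K (miss ts)) ≡⟨ cong₂ _+_ (cubeSum-ones K) (1+cubeSum-miss K ts) ⟩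
  2 ^ K + 2 ^ K                                   ≡⟨ cong (2 ^ K +_) (sym (+-identityʳ _)) ⟩
  2 ^ suc K                                       ∎
  where open ≡-Reasoning

indicator : Bool → ℕ
indicator b = if b then 1 else 0

indicator-true : ∀ {b} → T b → indicator b ≡ 1
indicator-true {true} _ = refl

indicator-*-mono : ∀ b {x y} → (T b → x ≤ y) → indicator b * x ≤ indicator b * y
indicator-*-mono true  x≤y = *-monoʳ-≤ 1 (x≤y tt)
indicator-*-mono false _   = z≤n

cubeSum-ofSize≤ : ∀ N n → cubeSum N (λ A → indicator (∣ A ∣ ≡ᵇ n)) ≤ N ^ n
cubeSum-ofSize≤ zero    zero    = ≤-refl
cubeSum-ofSize≤ zero    (suc n) = z≤n
cubeSum-ofSize≤ (suc N) zero    =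
  ≤-trans (≤-reflexive (cong (_+ cubeSum N (λ A → indicator (∣ A ∣ ≡ᵇ 0)))
                              (trans (cubeSum-const N 0) (*-zeroʳ (2 ^ N)))))
          (cubeSum-ofSize≤ N zero)
cubeSum-ofSize≤ (suc N) (suc n) = begin
  cubeSum N (λ A → indicator (∣ A ∣ ≡ᵇ n)) + cubeSum N (λ A → indicator (∣ A ∣ ≡ᵇ suc n))
    ≤⟨ +-mono-≤ (cubeSum-ofSize≤ N n) (cubeSum-ofSize≤ N (suc n)) ⟩
  N ^ n + N * N ^ n ≤⟨ *-monoʳ-≤ (suc N) (^-monoˡ-≤ n (n≤1+n N)) ⟩
  suc N * suc N ^ n ∎
  where open ≤-Reasoning

first-moment : ∀ {N M n D E} (bad : Subset N → Vec Bool M → ℕ) →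
  (∀ A → ∣ A ∣ ≡ n → cubeSum M (bad A) * D ≤ E * 2 ^ M) → N ^ n * E < D →
  ∃ λ v → ∀ A → ∣ A ∣ ≡ n → bad A v ≡ 0
first-moment {N} {M} {n} {D} {E} bad bound NⁿE<D =
  let v , Fv≡0 = cubeSum<2^M⇒∃≡0 M F ∑F<2^M
  in v , λ A ∣A∣≡n → begin-equality
    bad A v           ≡⟨ sym (*-identityˡ (bad A v)) ⟩
    1 * bad A v       ≡⟨ cong (_* bad A v) (sym (indicator-true (≡⇒≡ᵇ _ n ∣A∣≡n))) ⟩
    sized A * bad A v ≡⟨ cubeSum≡0⇒≡0 N (λ A → sized A * bad A v) Fv≡0 A ⟩
    0                 ∎
  where
  open ≤-Reasoning
  sized : Subset N → ℕ
  sized A = indicator (∣ A ∣ ≡ᵇ n)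
  F : Vec Bool M → ℕ
  F v = cubeSum N (λ A → sized A * bad A v)
  ∑F<2^M : cubeSum M F < 2 ^ M
  ∑F<2^M = *-cancelʳ-< D (cubeSum M F) (2 ^ M) (begin-strict
    cubeSum M F * D
      ≡⟨ cong (_* D) (cubeSum-comm M N (λ v A → sized A * bad A v)) ⟩
    cubeSum N (λ A → cubeSum M (λ v → sized A * bad A v)) * D
      ≡⟨ sym (cubeSum-*ʳ N D _) ⟩
    cubeSum N (λ A → cubeSum M (λ v → sized A * bad A v) * D)
      ≡⟨ cubeSum-cong N (λ A → trans (cong (_* D) (cubeSum-*ˡ M (sized A) (bad A))) (*-assoc (sized A) _ D)) ⟩
    cubeSum N (λ A → sized A * (cubeSum M (bad A) * D))
      ≤⟨ cubeSum-mono-≤ N (λ A → indicator-*-mono (∣ A ∣ ≡ᵇ n) (bound A ∘ ≡ᵇ⇒≡ _ n)) ⟩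
    cubeSum N (λ A → sized A * (E * 2 ^ M))
      ≡⟨ cubeSum-*ʳ N (E * 2 ^ M) sized ⟩
    cubeSum N sized * (E * 2 ^ M)
      ≤⟨ *-monoˡ-≤ (E * 2 ^ M) (cubeSum-ofSize≤ N n) ⟩
    N ^ n * (E * 2 ^ M)
      ≡⟨ sym (*-assoc (N ^ n) E _) ⟩
    N ^ n * E * 2 ^ M
      <⟨ *-monoˡ-< (2 ^ M) {{m^n≢0 2 M}} NⁿE<D ⟩
    D * 2 ^ M
      ≡⟨ *-comm D (2 ^ M) ⟩
    2 ^ M * D ∎)

affine-unique-< : ∀ {a b a′ b′ i j} → i < j →
                  a * i + b ≡ a′ * i + b′ → a * j + b ≡ a′ * j + b′ → a ≡ a′ × b ≡ b′
affine-unique-< {a} {b} {a′} {b′} {i} i<j eqᵢ eqⱼ with m≤n⇒∃[o]m+o≡n i<j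
... | o , refl = a≡a′ , +-cancelˡ-≡ (a * i) b b′ (trans eqᵢ (cong (λ x → x * i + b′) (sym a≡a′)))
  where
  shift : ∀ a b i o → a * suc (i + o) + b ≡ (a * i + b) + a * suc o
  shift = solve-∀
  a≡a′ : a ≡ a′
  a≡a′ = *-cancelʳ-≡ a a′ (suc o) (+-cancelˡ-≡ (a′ * i + b′) _ _
           (trans (cong (_+ a * suc o) (sym eqᵢ)) (trans (sym (shift a b i o)) (trans eqⱼ (shift a′ b′ i o)))))

affine-unique : ∀ {a b a′ b′ i j} → i ≢ j →
                a * i + b ≡ a′ * i + b′ → a * j + b ≡ a′ * j + b′ → a ≡ a′ × b ≡ b′
affine-unique {i = i} {j} i≢j eqᵢ eqⱼ with <-cmp i j
... | tri< i<j _ _ = affine-unique-< i<j eqᵢ eqⱼ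
... | tri≈ _ i≡j _ = ⊥-elim (i≢j i≡j)
... | tri> _ _ j<i = affine-unique-< j<i eqⱼ eqᵢ

strictMono⇒injective : ∀ {m n} (e : Fin m → Fin n) → e Preserves F._<_ ⟶ F._<_ → Injective _≡_ _≡_ e
strictMono⇒injective e e-mono {i} {j} eq with Finₚ.<-cmp i j
... | tri< i<j _ _ = ⊥-elim (Finₚ.<⇒≢ (e-mono i<j) eq)
... | tri≈ _ i≡j _ = i≡j
... | tri> _ _ j<i = ⊥-elim (Finₚ.<⇒≢ (e-mono j<i) (sym eq))

-- point a b x is the cell (x, a x + b) of the 6 × 6k grid, laid out row by row along e.
module GridLines {N s : ℕ} (e : Fin s → Fin N) (e-mono : e Preserves F._<_ ⟶ F._<_)
             (k : ℕ) (36k≤s : 6 * (6 * k) ≤ s) where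

  height<6k : (a b : Fin k) (x : Fin 6) → toℕ a * toℕ x + toℕ b < 6 * k
  height<6k a b x = begin-strict
    toℕ a * toℕ x + toℕ b ≡⟨ +-comm (toℕ a * toℕ x) (toℕ b) ⟩
    toℕ b + toℕ a * toℕ x <⟨ +-monoˡ-< (toℕ a * toℕ x) (Finₚ.toℕ<n b) ⟩
    k + toℕ a * toℕ x     ≤⟨ +-monoʳ-≤ k (*-mono-≤ (<⇒≤ (Finₚ.toℕ<n a)) (Finₚ.toℕ≤pred[n] x)) ⟩
    k + k * 5             ≡⟨ cong (k +_) (*-comm k 5) ⟩
    6 * k                 ∎
    where open ≤-Reasoning

  point : Fin k → Fin k → Fin 6 → Fin N
  point a b x = e (inject≤ (combine x (fromℕ< (height<6k a b x))) 36k≤s)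

  point-mono : ∀ a b → point a b Preserves F._<_ ⟶ F._<_
  point-mono a b x<x′ = e-mono (subst₂ _<_ (sym (Finₚ.toℕ-inject≤ _ 36k≤s)) (sym (Finₚ.toℕ-inject≤ _ 36k≤s))
                                         (Finₚ.combine-monoˡ-< _ _ x<x′))

  point-injective : ∀ a b x a′ b′ x′ → point a b x ≡ point a′ b′ x′ →
                    x ≡ x′ × toℕ a * toℕ x + toℕ b ≡ toℕ a′ * toℕ x′ + toℕ b′
  point-injective a b x a′ b′ x′ eq =
      proj₁ same-cell
    , trans (sym (Finₚ.toℕ-fromℕ< (height<6k a b x)))
            (trans (cong toℕ (proj₂ same-cell)) (Finₚ.toℕ-fromℕ< (height<6k a′ b′ x′)))
    where
    same-cell : x ≡ x′ × fromℕ< (height<6k a b x) ≡ fromℕ< (height<6k a′ b′ x′)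
    same-cell = Finₚ.combine-injective x _ x′ _
                  (Finₚ.inject≤-injective 36k≤s 36k≤s _ _ (strictMono⇒injective e e-mono eq))

  lines-meet-once : ∀ {a b a′ b′ i j} → i ≢ j →
                    point a b i ≡ point a′ b′ i → point a b j ≡ point a′ b′ j → (a , b) ≡ (a′ , b′)
  lines-meet-once {a} {b} {a′} {b′} {i} {j} i≢j eqᵢ eqⱼ =
    cong₂ _,_ (Finₚ.toℕ-injective (proj₁ same)) (Finₚ.toℕ-injective (proj₂ same))
    where
    same : toℕ a ≡ toℕ a′ × toℕ b ≡ toℕ b′
    same = affine-unique (i≢j ∘ Finₚ.toℕ-injective)
             (proj₂ (point-injective a b i a′ b′ i eqᵢ)) (proj₂ (point-injective a b j a′ b′ j eqⱼ))

  edge : Fin k → Fin k → Fin 6 × Fin 6 → Fin (N * N)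
  edge a b (i , j) = combine (point a b i) (point a b j)

  edge-injective : ∀ a b a′ b′ p p′ → edge a b p ≡ edge a′ b′ p′ →
                   p ≡ p′ × point a b (proj₁ p) ≡ point a′ b′ (proj₁ p) × point a b (proj₂ p) ≡ point a′ b′ (proj₂ p)
  edge-injective a b a′ b′ (i , j) (i′ , j′) eq with Finₚ.combine-injective _ _ _ _ eq
  ... | eqᵢ , eqⱼ with point-injective a b i a′ b′ i′ eqᵢ | point-injective a b j a′ b′ j′ eqⱼ
  ...   | refl , _ | refl , _ = refl , eqᵢ , eqⱼ

  module _ {K} (E : Vec (Fin 6 × Fin 6) K) where

    lineEdges : Fin k → Fin k → Fin K → Fin (N * N)
    lineEdges a b = edge a b ∘ lookup E

    lineEdges-injective : Unique E → ∀ a b → Injective _≡_ _≡_ (lineEdges a b)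
    lineEdges-injective E-unique a b {l} {l′} eq =
      lookup-injective E-unique l l′ (proj₁ (edge-injective a b a b (lookup E l) (lookup E l′) eq))

    lineEdges-disjoint : (∀ l → proj₁ (lookup E l) ≢ proj₂ (lookup E l)) →
                         ∀ {a b a′ b′} → (a , b) ≢ (a′ , b′) → Disjoint (lineEdges a b) (lineEdges a′ b′)
    lineEdges-disjoint loopless {a} {b} {a′} {b′} ab≢a′b′ l l′ eq =
      let _ , meetᵢ , meetⱼ = edge-injective a b a′ b′ (lookup E l) (lookup E l′) eq
      in ab≢a′b′ (lines-meet-once (loopless l) meetᵢ meetⱼ)

^-distribʳ-* : ∀ a b t → (a * b) ^ t ≡ a ^ t * b ^ t
^-distribʳ-* a b zero    = refl
^-distribʳ-* a b (suc t) = trans (cong (a * b *_) (^-distribʳ-* a b t)) (reorder a b (a ^ t) (b ^ t))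
  where
  reorder : ∀ a b x y → a * b * (x * y) ≡ a * x * (b * y)
  reorder = solve-∀

^-cancelˡ-< : ∀ q {x y} → x ^ q < y ^ q → x < y
^-cancelˡ-< q xᵠ<yᵠ = ≰⇒> (λ y≤x → <⇒≱ xᵠ<yᵠ (^-monoˡ-≤ q y≤x))

m^q≤2^n⇒q≤n : ∀ {m q n} → 2 ≤ m → m ^ q ≤ 2 ^ n → q ≤ n
m^q≤2^n⇒q≤n {m} {q} {n} 2≤m mᵠ≤2ⁿ =
  ≮⇒≥ (λ n<q → <⇒≱ (^-monoʳ-< 2 ≤-refl n<q) (≤-trans (^-monoˡ-≤ q 2≤m) mᵠ≤2ⁿ))

m<2[m/n]n : ∀ m n .{{_ : NonZero n}} → n ≤ m → m < 2 * (m / n * n)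
m<2[m/n]n m n n≤m = begin-strict
  m                         ≡⟨ m≡m%n+[m/n]*n m n ⟩
  m % n + m / n * n         <⟨ +-monoˡ-< (m / n * n) (m%n<n m n) ⟩
  n + m / n * n             ≤⟨ +-monoˡ-≤ (m / n * n) (≤-trans (≤-reflexive (sym (*-identityˡ n))) (*-monoˡ-≤ n (m≥n⇒m/n>0 n≤m))) ⟩
  m / n * n + m / n * n     ≡⟨ double (m / n * n) ⟩
  2 * (m / n * n)           ∎
  where
  open ≤-Reasoning
  double : ∀ x → x + x ≡ 2 * x
  double x = cong (x +_) (sym (+-identityʳ x))

-- 2048 counts the colourings of the 11 edges of a 6-tuple; 5184 = 72², where n < 72 ⌊n/36⌋.
c⁻¹ : ℕ
c⁻¹ = 2048 * 5184

2*2047^2048≤2048^2048 : 2 * 2047 ^ 2048 ≤ 2048 ^ 2048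
2*2047^2048≤2048^2048 = toWitness {a? = 2 * 2047 ^ 2048 ≤? 2048 ^ 2048} _

2ᵘ*2047ˢ≤2048ˢ : ∀ {u s} → 2048 * u ≤ s → 2 ^ u * 2047 ^ s ≤ 2048 ^ s
2ᵘ*2047ˢ≤2048ˢ {u} 2048u≤s with m≤n⇒∃[o]m+o≡n 2048u≤s
... | o , refl = begin
  2 ^ u * 2047 ^ (2048 * u + o)             ≡⟨ cong (2 ^ u *_) (^-distribˡ-+-* 2047 (2048 * u) o) ⟩
  2 ^ u * (2047 ^ (2048 * u) * 2047 ^ o)    ≡⟨ sym (*-assoc (2 ^ u) _ _) ⟩
  2 ^ u * 2047 ^ (2048 * u) * 2047 ^ o      ≡⟨ cong (λ x → 2 ^ u * x * 2047 ^ o) (sym (^-*-assoc 2047 2048 u)) ⟩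
  2 ^ u * (2047 ^ 2048) ^ u * 2047 ^ o      ≡⟨ cong (_* 2047 ^ o) (sym (^-distribʳ-* 2 (2047 ^ 2048) u)) ⟩
  (2 * 2047 ^ 2048) ^ u * 2047 ^ o          ≤⟨ *-mono-≤ (^-monoˡ-≤ u 2*2047^2048≤2048^2048) (^-monoˡ-≤ o (n≤1+n 2047)) ⟩
  (2048 ^ 2048) ^ u * 2048 ^ o              ≡⟨ cong (_* 2048 ^ o) (^-*-assoc 2048 2048 u) ⟩
  2048 ^ (2048 * u) * 2048 ^ o              ≡⟨ sym (^-distribˡ-+-* 2048 (2048 * u) o) ⟩
  2048 ^ (2048 * u + o)                     ∎
  where open ≤-Reasoning

Nⁿ*2047^k²<2048^k² : ∀ {q n N} → c⁻¹ ≤ q → q ≤ n → N ^ q ≤ 2 ^ n →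
                     N ^ n * 2047 ^ (n / 36 * (n / 36)) < 2048 ^ (n / 36 * (n / 36))
Nⁿ*2047^k²<2048^k² {q} {n} {N} c⁻¹≤q q≤n Nᵠ≤2ⁿ = ^-cancelˡ-< q (begin-strict
  (N ^ n * 2047 ^ k²) ^ q       ≡⟨ ^-distribʳ-* (N ^ n) (2047 ^ k²) q ⟩
  (N ^ n) ^ q * (2047 ^ k²) ^ q ≡⟨ cong ((N ^ n) ^ q *_) (^-*-assoc 2047 k² q) ⟩
  (N ^ n) ^ q * 2047 ^ (k² * q) ≤⟨ *-monoˡ-≤ (2047 ^ (k² * q)) Nⁿᵠ≤2ⁿⁿ ⟩
  2 ^ (n * n) * 2047 ^ (k² * q) <⟨ *-monoˡ-< (2047 ^ (k² * q)) {{m^n≢0 2047 (k² * q)}} (^-monoʳ-< 2 ≤-refl n²<5184k²) ⟩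
  2 ^ (5184 * k²) * 2047 ^ (k² * q) ≤⟨ 2ᵘ*2047ˢ≤2048ˢ {5184 * k²} 2048[5184k²]≤k²q ⟩
  2048 ^ (k² * q)               ≡⟨ sym (^-*-assoc 2048 k² q) ⟩
  (2048 ^ k²) ^ q               ∎)
  where
  open ≤-Reasoning
  k k² : ℕ
  k = n / 36
  k² = k * k

  n²<5184k² : n * n < 5184 * k²
  n²<5184k² = <-≤-trans (*-mono-< n<72k n<72k) (≤-reflexive (square k))
    where
    n<72k : n < 2 * (k * 36)
    n<72k = m<2[m/n]n n 36 (≤-trans (toWitness {a? = 36 ≤? c⁻¹} _) (≤-trans c⁻¹≤q q≤n))
    square : ∀ k → 2 * (k * 36) * (2 * (k * 36)) ≡ 5184 * (k * k)
    square = solve-∀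

  2048[5184k²]≤k²q : 2048 * (5184 * k²) ≤ k² * q
  2048[5184k²]≤k²q = ≤-trans (≤-reflexive (reassoc k²)) (*-monoʳ-≤ k² c⁻¹≤q)
    where
    reassoc : ∀ x → 2048 * (5184 * x) ≡ x * (2048 * 5184)
    reassoc = solve-∀

  Nⁿᵠ≤2ⁿⁿ : (N ^ n) ^ q ≤ 2 ^ (n * n)
  Nⁿᵠ≤2ⁿⁿ = begin
    (N ^ n) ^ q ≡⟨ trans (^-*-assoc N n q) (trans (cong (N ^_) (*-comm n q)) (sym (^-*-assoc N q n))) ⟩
    (N ^ q) ^ n ≤⟨ ^-monoˡ-≤ n Nᵠ≤2ⁿ ⟩
    (2 ^ n) ^ n ≡⟨ ^-*-assoc 2 n n ⟩
    2 ^ (n * n) ∎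

patternEdges : Vec (Fin 6 × Fin 6) 11
patternEdges = (# 0 , # 3) ∷ (# 1 , # 3) ∷ (# 2 , # 3) ∷ (# 2 , # 4) ∷ (# 3 , # 4)
             ∷ (# 0 , # 1) ∷ (# 0 , # 2) ∷ (# 1 , # 2) ∷ (# 2 , # 5) ∷ (# 3 , # 5) ∷ (# 4 , # 5) ∷ []

patternIsRed : Vec Bool 11
patternIsRed = true ∷ true ∷ true ∷ true ∷ true ∷ false ∷ false ∷ false ∷ false ∷ false ∷ false ∷ []

patternEdges-unique : Unique patternEdges
patternEdges-unique =
  from-yes (allPairs? (λ e e′ → ¬? (Productₚ.≡-dec Finₚ._≟_ Finₚ._≟_ e e′)) patternEdges)

patternEdges-loopless : ∀ l → proj₁ (lookup patternEdges l) ≢ proj₂ (lookup patternEdges l)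
patternEdges-loopless =
  from-yes (Finₚ.all? λ l → ¬? (proj₁ (lookup patternEdges l) Finₚ.≟ proj₂ (lookup patternEdges l)))

colouring : ∀ {N} → Vec Bool (N * N) → Coloring N
colouring v x y = if lookup v (combine x y) then red else blue

enumerate : ∀ {N} (A : Subset N) → Fin ∣ A ∣ → Fin N
enumerate (true  ∷ A) zero    = zero
enumerate (true  ∷ A) (suc i) = suc (enumerate A i)
enumerate (false ∷ A) i       = suc (enumerate A i)

enumerate-∈ : ∀ {N} (A : Subset N) i → enumerate A i ∈ A
enumerate-∈ (true  ∷ A) zero    = here
enumerate-∈ (true  ∷ A) (suc i) = there (enumerate-∈ A i)
enumerate-∈ (false ∷ A) i       = there (enumerate-∈ A i)

enumerate-mono : ∀ {N} (A : Subset N) → enumerate A Preserves F._<_ ⟶ F._<_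
enumerate-mono (true  ∷ A) {zero}  {suc j} _         = s≤s z≤n
enumerate-mono (true  ∷ A) {suc i} {suc j} (s≤s i<j) = s≤s (enumerate-mono A i<j)
enumerate-mono (false ∷ A)                 i<j       = s≤s (enumerate-mono A i<j)

Good-vacuous : ∀ {N n} → N < n → Good N n
Good-vacuous N<n = (λ _ _ → red) , λ A ∣A∣≡n → ⊥-elim (<⇒≱ N<n (subst (_≤ _) ∣A∣≡n (∣p∣≤n A)))

module SubsetLines {N} (A : Subset N) where

  k : ℕ
  k = ∣ A ∣ / 36

  36k≤∣A∣ : 6 * (6 * k) ≤ ∣ A ∣
  36k≤∣A∣ = ≤-trans (≤-reflexive (trans (sym (*-assoc 6 6 k)) (*-comm 36 k))) (m/n*n≤m ∣ A ∣ 36)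

  open GridLines (enumerate A) (enumerate-mono A) k 36k≤∣A∣

  lineCoords : Fin (k * k) → Fin 11 → Fin (N * N)
  lineCoords = uncurry (lineEdges patternEdges) ∘ remQuot k

  bad : Vec Bool (N * N) → ℕ
  bad v = ∏ λ p → miss patternIsRed (v ↾ lineCoords p)

  cubeSum-bad : ∀ {n} → ∣ A ∣ ≡ n →
                cubeSum (N * N) bad * 2048 ^ (n / 36 * (n / 36)) ≡ 2047 ^ (n / 36 * (n / 36)) * 2 ^ (N * N)
  cubeSum-bad refl = trans
    (cubeSum-∏-independent lineCoords
      (λ p → uncurry (lineEdges-injective patternEdges patternEdges-unique) (remQuot k p))
      (λ p≢p′ → lineEdges-disjoint patternEdges patternEdges-loopless
                  (p≢p′ ∘ Injection.injective (↔⇒↣ Finₚ.*↔×)))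
      (miss patternIsRed))
    (cong (λ x → x ^ (k * k) * 2 ^ (N * N)) (suc-injective (1+cubeSum-miss 11 patternIsRed)))

  pattern-on-line : ∀ v a b → v ↾ lineEdges patternEdges a b ≡ patternIsRed → Pattern (colouring v) A
  pattern-on-line v a b hit =
    point a b (# 0) , point a b (# 1) , point a b (# 2) , point a b (# 3) , point a b (# 4) , point a b (# 5) ,
    (∈A , ∈A , ∈A , ∈A , ∈A , ∈A) ,
    (ordered (# 0) , ordered (# 1) , ordered (# 2) , ordered (# 3) , ordered (# 4)) ,
    (colour (# 0) , colour (# 1) , colour (# 2) , colour (# 3) , colour (# 4)) ,
    (colour (# 5) , colour (# 6) , colour (# 7) , colour (# 8) , colour (# 9) , colour (# 10))
    where
    ordered : ∀ (i : Fin 5) → point a b (F.inject₁ i) F.< point a b (suc i)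
    ordered i = point-mono a b (≤-reflexive (cong suc (Finₚ.toℕ-inject₁ i)))
    ∈A : ∀ {i} → enumerate A i ∈ A
    ∈A = enumerate-∈ A _
    colour : ∀ l → (if lookup v (lineEdges patternEdges a b l) then red else blue)
                 ≡ (if lookup patternIsRed l then red else blue)
    colour l = cong (if_then red else blue)
                 (trans (sym (lookup∘tabulate (lookup v ∘ lineEdges patternEdges a b) l))
                        (cong (λ u → lookup u l) hit))

  bad≡0⇒Pattern : ∀ v → bad v ≡ 0 → Pattern (colouring v) A
  bad≡0⇒Pattern v bad≡0 =
    let p , miss≡0 = ∏≡0⇒∃≡0 (λ p → miss patternIsRed (v ↾ lineCoords p)) bad≡0
    in uncurry (pattern-on-line v) (remQuot k p) (miss≡0⇒≡ patternIsRed _ miss≡0)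

open SubsetLines using (bad; cubeSum-bad; bad≡0⇒Pattern)

Nᵠ≤2ⁿ⇒Good : ∀ {q n N} → c⁻¹ ≤ q → 5 ≤ n → N ^ q ≤ 2 ^ n → Good N n
Nᵠ≤2ⁿ⇒Good {q} {n} {N} c⁻¹≤q 5≤n Nᵠ≤2ⁿ with N <? n
... | yes N<n = Good-vacuous N<n
... | no  N≮n =
  let v , avoids = first-moment bad (λ A → ≤-reflexive ∘ cubeSum-bad A) (Nⁿ*2047^k²<2048^k² c⁻¹≤q q≤n Nᵠ≤2ⁿ)
  in colouring v , λ A ∣A∣≡n → bad≡0⇒Pattern A v (avoids A ∣A∣≡n)
  where
  q≤n : q ≤ n
  q≤n = m^q≤2^n⇒q≤n (≤-trans (s≤s (s≤s z≤n)) (≤-trans 5≤n (≮⇒≥ N≮n))) Nᵠ≤2ⁿ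

lemma3p1 : Σ ℕ λ p → Σ ℕ λ q → (0 < p) × (0 < q) ×
    ((n N : ℕ) → 5 ≤ n → IsFloorPow2 p q n N → Good N n)
lemma3p1 = 1 , c⁻¹ , s≤s z≤n , s≤s z≤n ,
  λ n N 5≤n (Nᶜ≤2ⁿ , _) → Nᵠ≤2ⁿ⇒Good {c⁻¹} ≤-refl 5≤n (subst (λ m → N ^ c⁻¹ ≤ 2 ^ m) (*-identityˡ n) Nᶜ≤2ⁿ)
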